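{- For $n\ge1$, the bicentral Eulerian numbers satisfy $$A(2n,n)\equiv\begin{cases}1\pmod 3&\text{if } n\in 3T(01)+1,\\ -1\pmod 3&\text{if } n\in 3T(01)\text{ or } n\in 3T(01)+2,\\ 0\pmod 3&\text{otherwise.}\end{cases}$$
   Context: The Eulerian number $A(n,k)$ is the number of permutations of $\{1,\ldots,n\}$ with exactly $k-1$ descents; equivalently $A(n,k)=\sum_{i=0}^{k}(-1)^i(k-i)^n\binom{n+1}{i}$. $T(01)$ denotes the set of $m\in\mathbb{N}$ whose base-$3$ expansion contains only digits $0$ and $1$; for integers $k,l$, $kT(01)+l=\{km+l : m\in T(01)\}$. -}

module Defs where

open import Data.Nat as ℕ using (ℕ; zero; suc)
open import Data.Nat.Combinatorics using (_C_)
open import Data.Integer as ℤ using (ℤ; +_; -_; _-_)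
open import Data.Integer.Divisibility using (_∣_)
open import Data.Product using (Σ; _×_)
open import Relation.Binary.PropositionalEquality using (_≡_)

sgn : ℕ → ℤ
sgn zero = + 1
sgn (suc i) = - sgn i

sumTo : ℕ → (ℕ → ℤ) → ℤ
sumTo zero f = f 0
sumTo (suc k) f = sumTo k f ℤ.+ f (suc k)

eulerian : ℕ → ℕ → ℤ
eulerian n k = sumTo k (λ i → sgn i ℤ.* (+ (((k ℕ.∸ i) ℕ.^ n) ℕ.* (suc n C i))))

-- T01: the set of m whose base-3 expansion uses only digits 0 and 1.
-- Defined via the base-3 expansion: m ∈ T01 iff m = 0, or (m mod 3 ∈ {0,1} and ⌊m/3⌋ ∈ T01).
data T01 : ℕ → Set where
  t0   : T01 0
  dig0 : ∀ {m} → T01 m → T01 (3 ℕ.* m)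
  dig1 : ∀ {m} → T01 m → T01 (3 ℕ.* m ℕ.+ 1)

InAff : ℕ → ℕ → ℕ → Set
InAff k l n = Σ ℕ (λ m → T01 m × (n ≡ k ℕ.* m ℕ.+ l))

infix 4 _≡₃_
_≡₃_ : ℤ → ℤ → Set
a ≡₃ b = + 3 ∣ (a - b)

-- Work in ℤ₃. For n ≥ 1 Fermat gives (n − i)^{2n} ≡ [3 ∤ n − i], so
-- A(2n, n) ≡ Σ_{i ≤ n} (−1)^i [3 ∤ n − i] C(2n + 1, i). Write n = 3m + r, 2n + 1 = 3A + R and
-- i = 3b + s in base 3. By Lucas' theorem each term factors as (−1)^b C(A, b) times a factor
-- depending only on the digits r, R, s, so a block of three consecutive i contributes
-- (−1)^b C(A, b) times −1, 1 or −1 according as r = 0, 1 or 2. The alternating partial sum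
-- Σ_{b ≤ m} (−1)^b C(2m + 1, b) telescopes by Pascal's rule to (−1)^m C(2m, m); for r = 0 the
-- sum stops at b = m − 1 and C(2m, m) = 2 C(2m − 1, m − 1) gives the same value.
-- Finally Lucas' theorem applied to C(2m, m) digit by digit shows (−1)^m C(2m, m) ≡ 1 when
-- m ∈ T(01) and ≡ 0 otherwise: a digit d ∈ {0, 1} of m contributes (−1)^d C(2d, d) ≡ 1, a digit 2
-- contributes C(1, 2) = 0.

module Submission where

open import Defs
open import Data.Bool using (Bool; true; false; _∧_; T)
open import Data.Bool.Properties using (T-∧)
open import Data.Empty using (⊥-elim)
open import Data.Fin using (Fin; toℕ)
open import Data.Fin.Patterns using (0F; 1F; 2F)
open import Data.Fin.Properties using (toℕ<n)
open import Data.Integer as ℤ using (ℤ; +_; -_; -[1+_]; _⊖_)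
open import Data.Integer.Divisibility using (_∣_)
import Data.Integer.Properties as ℤ
open import Data.Nat as ℕ using (ℕ; zero; suc; _+_; _*_; _∸_; _^_; _≤_; _<_; _≥_; z≤n; s≤s; z<s)
open import Data.Nat.Combinatorics using (_C_; nCk+nC[k+1]≡[n+1]C[k+1]; nCk≡nC[n∸k]; k>n⇒nCk≡0)
open import Data.Nat.Divisibility as ℕ using (divides)
open import Data.Nat.Properties
open import Data.Nat.Tactic.RingSolver using (solve-∀)
open import Data.Product using (_×_; _,_; proj₁; proj₂)
open import Data.Sum using (_⊎_; inj₁; inj₂; [_,_])
open import Function using (_∘_)
open import Function.Bundles using (Equivalence)
open import Relation.Binary.PropositionalEquality using (_≡_; refl; sym; trans; cong; cong₂; subst; module ≡-Reasoning)
open import Relation.Nullary using (¬_)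

data ℤ₃ : Set where
  0₃ 1₃ 2₃ : ℤ₃

infix  8 -₃_
infixr 8 _^₃_
infixl 7 _*₃_
infixl 6 _+₃_ _-₃_

-₃_ : ℤ₃ → ℤ₃
-₃ 0₃ = 0₃
-₃ 1₃ = 2₃
-₃ 2₃ = 1₃

_+₃_ : ℤ₃ → ℤ₃ → ℤ₃
0₃ +₃ y  = y
1₃ +₃ 0₃ = 1₃
1₃ +₃ 1₃ = 2₃
1₃ +₃ 2₃ = 0₃
2₃ +₃ 0₃ = 2₃
2₃ +₃ 1₃ = 0₃
2₃ +₃ 2₃ = 1₃

_-₃_ : ℤ₃ → ℤ₃ → ℤ₃
x -₃ y = x +₃ -₃ y

_*₃_ : ℤ₃ → ℤ₃ → ℤ₃
0₃ *₃ y = 0₃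
1₃ *₃ y = y
2₃ *₃ y = -₃ y

_^₃_ : ℤ₃ → ℕ → ℤ₃
x ^₃ zero  = 1₃
x ^₃ suc k = x *₃ x ^₃ k

nonzero₃ : ℤ₃ → ℤ₃
nonzero₃ 0₃ = 0₃
nonzero₃ _  = 1₃

sign₃ : ℕ → ℤ₃
sign₃ i = (-₃ 1₃) ^₃ i

_==₃_ : ℤ₃ → ℤ₃ → Bool
0₃ ==₃ 0₃ = true
1₃ ==₃ 1₃ = true
2₃ ==₃ 2₃ = true
_  ==₃ _  = false

==₃-sound : ∀ x y → T (x ==₃ y) → x ≡ y
==₃-sound 0₃ 0₃ _ = refl
==₃-sound 1₃ 1₃ _ = refl
==₃-sound 2₃ 2₃ _ = refl

allℤ₃ : (ℤ₃ → Bool) → Bool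
allℤ₃ p = p 0₃ ∧ p 1₃ ∧ p 2₃

allℤ₃-sound : ∀ p → T (allℤ₃ p) → ∀ x → T (p x)
allℤ₃-sound p h 0₃ = proj₁ (Equivalence.to (T-∧ {p 0₃}) h)
allℤ₃-sound p h 1₃ = proj₁ (Equivalence.to (T-∧ {p 1₃}) (proj₂ (Equivalence.to (T-∧ {p 0₃}) h)))
allℤ₃-sound p h 2₃ = proj₂ (Equivalence.to (T-∧ {p 1₃}) (proj₂ (Equivalence.to (T-∧ {p 0₃}) h)))

Op₃ : ℕ → Set
Op₃ zero    = ℤ₃
Op₃ (suc k) = ℤ₃ → Op₃ k

Identity₃ : ∀ k → Op₃ k → Op₃ k → Set
Identity₃ zero    x y = x ≡ y
Identity₃ (suc k) f g = ∀ x → Identity₃ k (f x) (g x)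

agreesEverywhere : ∀ k → Op₃ k → Op₃ k → Bool
agreesEverywhere zero    x y = x ==₃ y
agreesEverywhere (suc k) f g = allℤ₃ λ x → agreesEverywhere k (f x) (g x)

ℤ₃-law : ∀ k (f g : Op₃ k) → {T (agreesEverywhere k f g)} → Identity₃ k f g
ℤ₃-law zero    x y {h} = ==₃-sound x y h
ℤ₃-law (suc k) f g {h} x = ℤ₃-law k (f x) (g x) {allℤ₃-sound (λ y → agreesEverywhere k (f y) (g y)) h x}

-- Reduction modulo 3

res : ℕ → ℤ₃
res zero    = 0₃
res (suc n) = 1₃ +₃ res n

res-+ : ∀ m n → res (m + n) ≡ res m +₃ res n
res-+ zero    n = refl
res-+ (suc m) n = trans (cong (1₃ +₃_) (res-+ m n))
  (ℤ₃-law 2 (λ a b → 1₃ +₃ (a +₃ b)) (λ a b → 1₃ +₃ a +₃ b) (res m) (res n))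

res-* : ∀ m n → res (m * n) ≡ res m *₃ res n
res-* zero    n = refl
res-* (suc m) n = trans (res-+ n (m * n)) (trans (cong (res n +₃_) (res-* m n))
  (ℤ₃-law 2 (λ a b → b +₃ a *₃ b) (λ a b → (1₃ +₃ a) *₃ b) (res m) (res n)))

res-^ : ∀ m k → res (m ^ k) ≡ res m ^₃ k
res-^ m zero    = refl
res-^ m (suc k) = trans (res-* m (m ^ k)) (cong (res m *₃_) (res-^ m k))

res-3*+ : ∀ q x → res (3 * q + x) ≡ res x
res-3*+ q x = trans (res-+ (3 * q) x) (cong (_+₃ res x) (res-* 3 q))

res-∸ : ∀ {i n} → i ≤ n → res (n ∸ i) ≡ res n -₃ res i
res-∸ {i} {n} i≤n = begin
  res (n ∸ i)                      ≡⟨ ℤ₃-law 2 (λ a b → b) (λ a b → a +₃ b -₃ a) (res i) (res (n ∸ i)) ⟩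
  res i +₃ res (n ∸ i) -₃ res i    ≡⟨ cong (_-₃ res i) (sym (res-+ i (n ∸ i))) ⟩
  res (i + (n ∸ i)) -₃ res i       ≡⟨ cong (λ k → res k -₃ res i) (m+[n∸m]≡n i≤n) ⟩
  res n -₃ res i                   ∎
  where open ≡-Reasoning

res≡0⇒3∣ : ∀ n → res n ≡ 0₃ → 3 ℕ.∣ n
res≡0⇒3∣ 0 _ = divides 0 refl
res≡0⇒3∣ 1 ()
res≡0⇒3∣ 2 ()
res≡0⇒3∣ (suc (suc (suc n))) h with res≡0⇒3∣ n (trans (sym (res-3*+ 1 n)) h)
... | divides q n≡q*3 = divides (suc q) (cong (λ k → 3 + k) n≡q*3)

resᶻ : ℤ → ℤ₃
resᶻ (+ n)    = res n
resᶻ -[1+ n ] = -₃ res (suc n)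

resᶻ-⊖ : ∀ m n → resᶻ (m ⊖ n) ≡ res m -₃ res n
resᶻ-⊖ m       zero    = ℤ₃-law 1 (λ a → a) (λ a → a -₃ 0₃) (res m)
resᶻ-⊖ zero    (suc n) = refl
resᶻ-⊖ (suc m) (suc n) = trans (cong resᶻ (ℤ.[1+m]⊖[1+n]≡m⊖n m n)) (trans (resᶻ-⊖ m n)
  (ℤ₃-law 2 (λ a b → a -₃ b) (λ a b → (1₃ +₃ a) -₃ (1₃ +₃ b)) (res m) (res n)))

resᶻ-neg : ∀ x → resᶻ (- x) ≡ -₃ resᶻ x
resᶻ-neg (+ zero)  = refl
resᶻ-neg (+ suc n) = refl
resᶻ-neg -[1+ n ]  = ℤ₃-law 1 (λ a → a) (λ a → -₃ -₃ a) (res (suc n))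

resᶻ-+ : ∀ x y → resᶻ (x ℤ.+ y) ≡ resᶻ x +₃ resᶻ y
resᶻ-+ (+ m)    (+ n)    = res-+ m n
resᶻ-+ (+ m)    -[1+ n ] = resᶻ-⊖ m (suc n)
resᶻ-+ -[1+ m ] (+ n)    = trans (resᶻ-⊖ n (suc m))
  (ℤ₃-law 2 (λ a b → a -₃ b) (λ a b → -₃ b +₃ a) (res n) (res (suc m)))
resᶻ-+ -[1+ m ] -[1+ n ] = trans (cong (λ t → -₃ (1₃ +₃ (1₃ +₃ t))) (res-+ m n))
  (ℤ₃-law 2 (λ a b → -₃ (1₃ +₃ (1₃ +₃ (a +₃ b)))) (λ a b → -₃ (1₃ +₃ a) +₃ -₃ (1₃ +₃ b)) (res m) (res n))

resᶻ-sgn-* : ∀ i x → resᶻ (sgn i ℤ.* x) ≡ sign₃ i *₃ resᶻ x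
resᶻ-sgn-* zero    x = cong resᶻ (ℤ.*-identityˡ x)
resᶻ-sgn-* (suc i) x = begin
  resᶻ (- sgn i ℤ.* x)       ≡⟨ cong resᶻ (sym (ℤ.neg-distribˡ-* (sgn i) x)) ⟩
  resᶻ (- (sgn i ℤ.* x))     ≡⟨ resᶻ-neg (sgn i ℤ.* x) ⟩
  -₃ resᶻ (sgn i ℤ.* x)      ≡⟨ cong -₃_ (resᶻ-sgn-* i x) ⟩
  -₃ (sign₃ i *₃ resᶻ x)     ≡⟨ ℤ₃-law 2 (λ s y → -₃ (s *₃ y)) (λ s y → -₃ 1₃ *₃ s *₃ y) (sign₃ i) (resᶻ x) ⟩
  sign₃ (suc i) *₃ resᶻ x    ∎
  where open ≡-Reasoning

resᶻ≡0⇒3∣ : ∀ x → resᶻ x ≡ 0₃ → + 3 ∣ x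
resᶻ≡0⇒3∣ (+ n)    h = res≡0⇒3∣ n h
resᶻ≡0⇒3∣ -[1+ n ] h = res≡0⇒3∣ (suc n)
  (trans (ℤ₃-law 1 (λ a → a) (λ a → -₃ -₃ a) (res (suc n))) (cong -₃_ h))

resᶻ-≡⇒≡₃ : ∀ x y → resᶻ x ≡ resᶻ y → x ≡₃ y
resᶻ-≡⇒≡₃ x y h = resᶻ≡0⇒3∣ (x ℤ.- y) (begin
  resᶻ (x ℤ.+ - y)         ≡⟨ resᶻ-+ x (- y) ⟩
  resᶻ x +₃ resᶻ (- y)     ≡⟨ cong₂ _+₃_ h (resᶻ-neg y) ⟩
  resᶻ y -₃ resᶻ y         ≡⟨ ℤ₃-law 1 (λ a → a -₃ a) (λ _ → 0₃) (resᶻ y) ⟩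
  0₃                       ∎)
  where open ≡-Reasoning

^₃-+ : ∀ x a b → x ^₃ (a + b) ≡ x ^₃ a *₃ x ^₃ b
^₃-+ x zero    b = refl
^₃-+ x (suc a) b = trans (cong (x *₃_) (^₃-+ x a b))
  (ℤ₃-law 3 (λ x p q → x *₃ (p *₃ q)) (λ x p q → x *₃ p *₃ q) x (x ^₃ a) (x ^₃ b))

^₃-2*suc : ∀ x k → x ^₃ (2 * suc k) ≡ nonzero₃ x
^₃-2*suc x k = trans (cong (x ^₃_) (*-suc 2 k)) (trans (^₃-+ x 2 (2 * k)) (square-times k))
  where
  square-times : ∀ k → x ^₃ 2 *₃ x ^₃ (2 * k) ≡ nonzero₃ x
  square-times zero    = ℤ₃-law 1 (λ x → x ^₃ 2 *₃ 1₃) nonzero₃ x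
  square-times (suc k) = trans (cong (x ^₃ 2 *₃_) (^₃-2*suc x k))
    (ℤ₃-law 1 (λ x → x ^₃ 2 *₃ nonzero₃ x) nonzero₃ x)

sign₃-3* : ∀ b → sign₃ (3 * b) ≡ sign₃ b
sign₃-3* zero    = refl
sign₃-3* (suc b) = trans (cong sign₃ (*-suc 3 b)) (trans (cong (λ s → -₃ -₃ -₃ s) (sign₃-3* b))
  (ℤ₃-law 1 (λ s → -₃ -₃ -₃ s) (λ s → -₃ s) (sign₃ b)))

sign₃-3*+ : ∀ b i → sign₃ (3 * b + i) ≡ sign₃ b *₃ sign₃ i
sign₃-3*+ b i = trans (^₃-+ (-₃ 1₃) (3 * b) i) (cong (_*₃ sign₃ i) (sign₃-3* b))

∑< : ℕ → (ℕ → ℤ₃) → ℤ₃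
∑< zero    f = 0₃
∑< (suc n) f = ∑< n f +₃ f n

syntax ∑< n (λ i → e) = ∑[ i < n ] e

resᶻ-sumTo : ∀ k f → resᶻ (sumTo k f) ≡ ∑[ i < suc k ] resᶻ (f i)
resᶻ-sumTo zero    f = refl
resᶻ-sumTo (suc k) f = trans (resᶻ-+ (sumTo k f) (f (suc k)))
  (cong (_+₃ resᶻ (f (suc k))) (resᶻ-sumTo k f))
∑-cong : ∀ n {f g : ℕ → ℤ₃} → (∀ i → i < n → f i ≡ g i) → ∑< n f ≡ ∑< n g
∑-cong zero    f≗g = refl
∑-cong (suc n) f≗g = cong₂ _+₃_ (∑-cong n (λ i i<n → f≗g i (m<n⇒m<1+n i<n))) (f≗g n ≤-refl)

∑-*ˡ : ∀ n c f → ∑[ i < n ] (c *₃ f i) ≡ c *₃ ∑< n f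
∑-*ˡ zero    c f = ℤ₃-law 1 (λ c → 0₃) (λ c → c *₃ 0₃) c
∑-*ˡ (suc n) c f = trans (cong (_+₃ c *₃ f n) (∑-*ˡ n c f))
  (ℤ₃-law 3 (λ c x y → c *₃ x +₃ c *₃ y) (λ c x y → c *₃ (x +₃ y)) c (∑< n f) (f n))

∑-last-vanishes : ∀ n f → f n ≡ 0₃ → ∑< (suc n) f ≡ ∑< n f
∑-last-vanishes n f fn≡0 = trans (cong (∑< n f +₃_) fn≡0) (ℤ₃-law 1 (λ x → x +₃ 0₃) (λ x → x) (∑< n f))

block : (ℕ → ℤ₃) → ℕ → ℤ₃
block f b = f (3 * b + 0) +₃ f (3 * b + 1) +₃ f (3 * b + 2)

∑-blocks : ∀ m f → ∑< (3 * m) f ≡ ∑[ b < m ] block f b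
∑-blocks zero    f = refl
∑-blocks (suc m) f = begin
  ∑< (3 * suc m) f
    ≡⟨ cong (λ k → ∑< k f) (*-suc 3 m) ⟩
  ∑< (3 * m) f +₃ f (3 * m) +₃ f (1 + 3 * m) +₃ f (2 + 3 * m)
    ≡⟨ cong₂ (λ x y → ∑< (3 * m) f +₃ x +₃ f (1 + 3 * m) +₃ y)
         (cong f (sym (+-identityʳ (3 * m)))) (cong f (+-comm 2 (3 * m))) ⟩
  ∑< (3 * m) f +₃ f (3 * m + 0) +₃ f (1 + 3 * m) +₃ f (3 * m + 2)
    ≡⟨ cong₂ (λ S x → S +₃ f (3 * m + 0) +₃ x +₃ f (3 * m + 2))
         (∑-blocks m f) (cong f (+-comm 1 (3 * m))) ⟩
  ∑< m (block f) +₃ f (3 * m + 0) +₃ f (3 * m + 1) +₃ f (3 * m + 2)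
    ≡⟨ ℤ₃-law 4 (λ S x y z → S +₃ x +₃ y +₃ z) (λ S x y z → S +₃ (x +₃ y +₃ z))
         (∑< m (block f)) (f (3 * m + 0)) (f (3 * m + 1)) (f (3 * m + 2)) ⟩
  ∑< m (block f) +₃ block f m ∎
  where open ≡-Reasoning

-- Binomial coefficients modulo 3

infix 9 _C₃_

_C₃_ : ℕ → ℕ → ℤ₃
N C₃ k = res (N C k)

C₃-pascal : ∀ N k → suc N C₃ suc k ≡ N C₃ k +₃ N C₃ suc k
C₃-pascal N k = trans (cong res (sym (nCk+nC[k+1]≡[n+1]C[k+1] N k))) (res-+ (N C k) (N C suc k))

C₃-vanishes : ∀ {N k} → N < k → N C₃ k ≡ 0₃
C₃-vanishes N<k = cong res (k>n⇒nCk≡0 N<k)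

-- Three Pascal steps produce the coefficients 1, 3, 3, 1 of (1 + x)³ ≡ 1 + x³.
C₃-frobenius : ∀ N k → (3 + N) C₃ (3 + k) ≡ N C₃ k +₃ N C₃ (3 + k)
C₃-frobenius N k =
  trans (C₃-pascal (2 + N) (2 + k))
  (trans (cong₂ _+₃_ (C₃-pascal (1 + N) (1 + k)) (C₃-pascal (1 + N) (2 + k)))
  (trans (cong₂ _+₃_ (cong₂ _+₃_ (C₃-pascal N k) (C₃-pascal N (1 + k)))
                     (cong₂ _+₃_ (C₃-pascal N (1 + k)) (C₃-pascal N (2 + k))))
  (ℤ₃-law 4 (λ x y z w → x +₃ y +₃ (y +₃ z) +₃ (y +₃ z +₃ (z +₃ w))) (λ x y z w → x +₃ w)
            (N C₃ k) (N C₃ (1 + k)) (N C₃ (2 + k)) (N C₃ (3 + k)))))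

C₃-frobenius-low : ∀ N (s : Fin 3) → (3 + N) C₃ toℕ s ≡ N C₃ toℕ s
C₃-frobenius-low N 0F = refl
C₃-frobenius-low N 1F =
  trans (C₃-pascal (2 + N) 0) (trans (cong (1₃ +₃_) (C₃-pascal (1 + N) 0))
  (trans (cong (λ t → 1₃ +₃ (1₃ +₃ t)) (C₃-pascal N 0))
  (ℤ₃-law 1 (λ y → 1₃ +₃ (1₃ +₃ (1₃ +₃ y))) (λ y → y) (N C₃ 1))))
C₃-frobenius-low N 2F =
  trans (C₃-pascal (2 + N) 1)
  (trans (cong₂ _+₃_ (C₃-pascal (1 + N) 0) (C₃-pascal (1 + N) 1))
  (trans (cong₂ _+₃_ (cong (1₃ +₃_) (C₃-pascal N 0)) (cong₂ _+₃_ (C₃-pascal N 0) (C₃-pascal N 1)))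
  (ℤ₃-law 2 (λ y z → 1₃ +₃ (1₃ +₃ y) +₃ (1₃ +₃ y +₃ (y +₃ z))) (λ y z → z) (N C₃ 1) (N C₃ 2))))

3[1+a]+x≡3+[3a+x] : ∀ a x → 3 * suc a + x ≡ 3 + (3 * a + x)
3[1+a]+x≡3+[3a+x] a x = cong (_+ x) (*-suc 3 a)

lucas : ∀ a b (r s : Fin 3) → (3 * a + toℕ r) C₃ (3 * b + toℕ s) ≡ a C₃ b *₃ toℕ r C₃ toℕ s
lucas zero    zero    r s = refl
lucas zero    (suc b) r s = C₃-vanishes (<-≤-trans (toℕ<n r)
  (≤-trans (m≤m+n 3 (3 * b + toℕ s)) (≤-reflexive (sym (3[1+a]+x≡3+[3a+x] b (toℕ s))))))
lucas (suc a) zero    r s = trans (cong (_C₃ toℕ s) (3[1+a]+x≡3+[3a+x] a (toℕ r)))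
  (trans (C₃-frobenius-low (3 * a + toℕ r) s) (lucas a zero r s))
lucas (suc a) (suc b) r s = begin
  (3 * suc a + toℕ r) C₃ (3 * suc b + toℕ s)
    ≡⟨ cong₂ _C₃_ (3[1+a]+x≡3+[3a+x] a (toℕ r)) (3[1+a]+x≡3+[3a+x] b (toℕ s)) ⟩
  (3 + (3 * a + toℕ r)) C₃ (3 + (3 * b + toℕ s))
    ≡⟨ C₃-frobenius (3 * a + toℕ r) (3 * b + toℕ s) ⟩
  (3 * a + toℕ r) C₃ (3 * b + toℕ s) +₃ (3 * a + toℕ r) C₃ (3 + (3 * b + toℕ s))
    ≡⟨ cong₂ _+₃_ (lucas a b r s)
         (trans (cong ((3 * a + toℕ r) C₃_) (sym (3[1+a]+x≡3+[3a+x] b (toℕ s)))) (lucas a (suc b) r s)) ⟩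
  a C₃ b *₃ ρ +₃ a C₃ suc b *₃ ρ
    ≡⟨ ℤ₃-law 3 (λ x y z → x *₃ z +₃ y *₃ z) (λ x y z → (x +₃ y) *₃ z) (a C₃ b) (a C₃ suc b) ρ ⟩
  (a C₃ b +₃ a C₃ suc b) *₃ ρ
    ≡⟨ cong (_*₃ ρ) (sym (C₃-pascal a b)) ⟩
  suc a C₃ suc b *₃ ρ ∎
  where
  open ≡-Reasoning
  ρ = toℕ r C₃ toℕ s

∑-alternating : ∀ N k → ∑[ b < suc k ] (sign₃ b *₃ suc N C₃ b) ≡ sign₃ k *₃ N C₃ k
∑-alternating N zero    = refl
∑-alternating N (suc k) = begin
  ∑[ b < suc k ] (sign₃ b *₃ suc N C₃ b) +₃ sign₃ (suc k) *₃ suc N C₃ suc k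
    ≡⟨ cong₂ (λ x y → x +₃ -₃ sign₃ k *₃ y) (∑-alternating N k) (C₃-pascal N k) ⟩
  sign₃ k *₃ N C₃ k +₃ -₃ sign₃ k *₃ (N C₃ k +₃ N C₃ suc k)
    ≡⟨ ℤ₃-law 3 (λ s x y → s *₃ x +₃ -₃ s *₃ (x +₃ y)) (λ s x y → -₃ s *₃ y) (sign₃ k) (N C₃ k) (N C₃ suc k) ⟩
  sign₃ (suc k) *₃ N C₃ suc k ∎
  where open ≡-Reasoning

-- The signed central binomial coefficient

central₃ : ℕ → ℤ₃
central₃ m = sign₃ m *₃ (2 * m) C₃ m

central₃-lucas : ∀ m A (R d : Fin 3) → 2 * (3 * m + toℕ d) ≡ 3 * A + toℕ R →
  central₃ (3 * m + toℕ d) ≡ sign₃ m *₃ A C₃ m *₃ (sign₃ (toℕ d) *₃ toℕ R C₃ toℕ d)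
central₃-lucas m A R d 2n≡3A+R = begin
  sign₃ (3 * m + toℕ d) *₃ (2 * (3 * m + toℕ d)) C₃ (3 * m + toℕ d)
    ≡⟨ cong₂ _*₃_ (sign₃-3*+ m (toℕ d)) (trans (cong (_C₃ (3 * m + toℕ d)) 2n≡3A+R) (lucas A m R d)) ⟩
  sign₃ m *₃ sign₃ (toℕ d) *₃ (A C₃ m *₃ toℕ R C₃ toℕ d)
    ≡⟨ ℤ₃-law 4 (λ a b c e → a *₃ b *₃ (c *₃ e)) (λ a b c e → a *₃ c *₃ (b *₃ e))
         (sign₃ m) (sign₃ (toℕ d)) (A C₃ m) (toℕ R C₃ toℕ d) ⟩
  sign₃ m *₃ A C₃ m *₃ (sign₃ (toℕ d) *₃ toℕ R C₃ toℕ d) ∎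
  where open ≡-Reasoning

central₃-3m+0 : ∀ m → central₃ (3 * m + 0) ≡ central₃ m
central₃-3m+0 m = trans (central₃-lucas m (2 * m) 0F 0F (double m))
  (ℤ₃-law 1 (λ c → c *₃ 1₃) (λ c → c) (central₃ m))
  where
  double : ∀ m → 2 * (3 * m + 0) ≡ 3 * (2 * m) + 0
  double = solve-∀

central₃-3m+1 : ∀ m → central₃ (3 * m + 1) ≡ central₃ m
central₃-3m+1 m = trans (central₃-lucas m (2 * m) 2F 1F (double m))
  (ℤ₃-law 1 (λ c → c *₃ 1₃) (λ c → c) (central₃ m))
  where
  double : ∀ m → 2 * (3 * m + 1) ≡ 3 * (2 * m) + 2
  double = solve-∀

central₃-3m+2 : ∀ m → central₃ (3 * m + 2) ≡ 0₃
central₃-3m+2 m = trans (central₃-lucas m (suc (2 * m)) 1F 2F (double m))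
  (ℤ₃-law 1 (λ c → c *₃ 0₃) (λ _ → 0₃) (sign₃ m *₃ suc (2 * m) C₃ m))
  where
  double : ∀ m → 2 * (3 * m + 2) ≡ 3 * suc (2 * m) + 1
  double = solve-∀

central₃-suc : ∀ k → central₃ (suc k) ≡ sign₃ k *₃ suc (2 * k) C₃ k
central₃-suc k = begin
  sign₃ (suc k) *₃ (2 * suc k) C₃ suc k
    ≡⟨ cong (λ M → -₃ sign₃ k *₃ M C₃ suc k) (*-suc 2 k) ⟩
  -₃ sign₃ k *₃ suc N C₃ suc k
    ≡⟨ cong (-₃ sign₃ k *₃_) (C₃-pascal N k) ⟩
  -₃ sign₃ k *₃ (N C₃ k +₃ N C₃ suc k)
    ≡⟨ cong (λ c → -₃ sign₃ k *₃ (N C₃ k +₃ c)) symmetric ⟩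
  -₃ sign₃ k *₃ (N C₃ k +₃ N C₃ k)
    ≡⟨ ℤ₃-law 2 (λ s c → -₃ s *₃ (c +₃ c)) (λ s c → s *₃ c) (sign₃ k) (N C₃ k) ⟩
  sign₃ k *₃ N C₃ k ∎
  where
  open ≡-Reasoning
  N = suc (2 * k)
  symmetric : N C₃ suc k ≡ N C₃ k
  symmetric = cong res (trans (nCk≡nC[n∸k] (s≤s (m≤m+n k (k + 0))))
    (cong (N C_) (trans (m+n∸m≡n k (k + 0)) (+-identityʳ k))))

central₃-T01 : ∀ {m} → T01 m → central₃ m ≡ 1₃
central₃-T01 t0           = refl
central₃-T01 (dig0 {m} t) = trans (cong central₃ (sym (+-identityʳ (3 * m))))
  (trans (central₃-3m+0 m) (central₃-T01 t))
central₃-T01 (dig1 {m} t) = trans (central₃-3m+1 m) (central₃-T01 t)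

-- Base-3 digits, least significant first; indexing by d + q * 3 makes base3-suc need no arithmetic.
data Base3 : ℕ → Set where
  []  : Base3 0
  _∷_ : ∀ {q} (d : Fin 3) → Base3 q → Base3 (toℕ d + q * 3)

base3-suc : ∀ {n} → Base3 n → Base3 (suc n)
base3-suc []        = 1F ∷ []
base3-suc (0F ∷ ds) = 1F ∷ ds
base3-suc (1F ∷ ds) = 2F ∷ ds
base3-suc (2F ∷ ds) = 0F ∷ base3-suc ds

base3 : ∀ n → Base3 n
base3 zero    = []
base3 (suc n) = base3-suc (base3 n)

x+q*3≡3q+x : ∀ x q → x + q * 3 ≡ 3 * q + x
x+q*3≡3q+x x q = trans (+-comm x (q * 3)) (cong (_+ x) (*-comm q 3))

central₃≡0⊎T01 : ∀ {m} → Base3 m → central₃ m ≡ 0₃ ⊎ T01 m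
central₃≡0⊎T01 []             = inj₂ t0
central₃≡0⊎T01 (_∷_ {q} d ds) =
  subst (λ n → central₃ n ≡ 0₃ ⊎ T01 n) (sym (x+q*3≡3q+x (toℕ d) q)) (appendDigit d (central₃≡0⊎T01 ds))
  where
  appendDigit : ∀ d → central₃ q ≡ 0₃ ⊎ T01 q → central₃ (3 * q + toℕ d) ≡ 0₃ ⊎ T01 (3 * q + toℕ d)
  appendDigit 0F (inj₁ c≡0) = inj₁ (trans (central₃-3m+0 q) c≡0)
  appendDigit 0F (inj₂ t)   = inj₂ (subst T01 (sym (+-identityʳ (3 * q))) (dig0 t))
  appendDigit 1F (inj₁ c≡0) = inj₁ (trans (central₃-3m+1 q) c≡0)
  appendDigit 1F (inj₂ t)   = inj₂ (dig1 t)
  appendDigit 2F _          = inj₁ (central₃-3m+2 q)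

-- The bicentral Eulerian numbers

A₃ : ℕ → ℤ₃
A₃ n = resᶻ (eulerian (2 * n) n)

-- (n − i)^{2n} reduces to nonzero₃ (res (n ∸ i)); for i ≥ n the truncated n ∸ i is 0, so the term vanishes.
eulerTerm : ℕ → ℕ → ℤ₃
eulerTerm n i = sign₃ i *₃ (nonzero₃ (res (n ∸ i)) *₃ suc (2 * n) C₃ i)

A₃-eulerTerm : ∀ n → 1 ≤ n → A₃ n ≡ ∑[ i < suc n ] eulerTerm n i
A₃-eulerTerm (suc k) _ = trans (resᶻ-sumTo n _) (∑-cong (suc n) (λ i _ → term≡ i))
  where
  n = suc k
  term≡ : ∀ i → resᶻ (sgn i ℤ.* + ((n ∸ i) ^ (2 * n) * (suc (2 * n) C i))) ≡ eulerTerm n i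
  term≡ i = begin
    resᶻ (sgn i ℤ.* + ((n ∸ i) ^ (2 * n) * (suc (2 * n) C i)))
      ≡⟨ resᶻ-sgn-* i _ ⟩
    sign₃ i *₃ res ((n ∸ i) ^ (2 * n) * (suc (2 * n) C i))
      ≡⟨ cong (sign₃ i *₃_) (res-* ((n ∸ i) ^ (2 * n)) (suc (2 * n) C i)) ⟩
    sign₃ i *₃ (res ((n ∸ i) ^ (2 * n)) *₃ suc (2 * n) C₃ i)
      ≡⟨ cong (λ p → sign₃ i *₃ (p *₃ suc (2 * n) C₃ i))
           (trans (res-^ (n ∸ i) (2 * n)) (^₃-2*suc (res (n ∸ i)) k)) ⟩
    eulerTerm n i ∎
    where open ≡-Reasoning

eulerTerm-vanishes : ∀ {n i} → n ≤ i → eulerTerm n i ≡ 0₃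
eulerTerm-vanishes {n} {i} n≤i =
  trans (cong (λ k → sign₃ i *₃ (nonzero₃ (res k) *₃ suc (2 * n) C₃ i)) (m≤n⇒m∸n≡0 n≤i))
  (ℤ₃-law 1 (λ s → s *₃ 0₃) (λ _ → 0₃) (sign₃ i))

-- The factor of eulerTerm n i coming from the lowest base-3 digits r of n, R of 2n + 1 and s of i.
digitTerm : (r R s : Fin 3) → ℤ₃
digitTerm r R s = sign₃ (toℕ s) *₃ (nonzero₃ (res (toℕ r) -₃ res (toℕ s)) *₃ toℕ R C₃ toℕ s)

digitFactor : (r R : Fin 3) → ℤ₃
digitFactor r R = digitTerm r R 0F +₃ digitTerm r R 1F +₃ digitTerm r R 2F

-- Past the end of the sum (i > n) the factorisation still holds as long as the digit binomial vanishes.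
eulerTerm-lucas : ∀ m A (r R : Fin 3) → suc (2 * (3 * m + toℕ r)) ≡ 3 * A + toℕ R →
  ∀ b (s : Fin 3) → 3 * b + toℕ s ≤ 3 * m + toℕ r ⊎ toℕ R < toℕ s →
  eulerTerm (3 * m + toℕ r) (3 * b + toℕ s) ≡ digitTerm r R s *₃ (sign₃ b *₃ A C₃ b)
eulerTerm-lucas m A r R 2n+1≡3A+R b s i≤n⊎R<s = begin
  eulerTerm n i
    ≡⟨ cong₂ (λ σ c → σ *₃ (nonzero₃ (res (n ∸ i)) *₃ c)) (sign₃-3*+ b (toℕ s))
         (trans (cong (_C₃ i) 2n+1≡3A+R) (lucas A b R s)) ⟩
  sign₃ b *₃ σ *₃ (nonzero₃ (res (n ∸ i)) *₃ (A C₃ b *₃ ρ))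
    ≡⟨ rearrange i≤n⊎R<s ⟩
  digitTerm r R s *₃ (sign₃ b *₃ A C₃ b) ∎
  where
  open ≡-Reasoning
  n = 3 * m + toℕ r
  i = 3 * b + toℕ s
  σ = sign₃ (toℕ s)
  ρ = toℕ R C₃ toℕ s
  δ = nonzero₃ (res (toℕ r) -₃ res (toℕ s))
  rearrange : i ≤ n ⊎ toℕ R < toℕ s →
    sign₃ b *₃ σ *₃ (nonzero₃ (res (n ∸ i)) *₃ (A C₃ b *₃ ρ)) ≡ σ *₃ (δ *₃ ρ) *₃ (sign₃ b *₃ A C₃ b)
  rearrange (inj₁ i≤n) = begin
    sign₃ b *₃ σ *₃ (nonzero₃ (res (n ∸ i)) *₃ (A C₃ b *₃ ρ))
      ≡⟨ cong (λ x → sign₃ b *₃ σ *₃ (nonzero₃ x *₃ (A C₃ b *₃ ρ)))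
           (trans (res-∸ i≤n) (cong₂ _-₃_ (res-3*+ m (toℕ r)) (res-3*+ b (toℕ s)))) ⟩
    sign₃ b *₃ σ *₃ (δ *₃ (A C₃ b *₃ ρ))
      ≡⟨ ℤ₃-law 5 (λ a b c d e → a *₃ b *₃ (c *₃ (d *₃ e))) (λ a b c d e → b *₃ (c *₃ e) *₃ (a *₃ d))
           (sign₃ b) σ δ (A C₃ b) ρ ⟩
    σ *₃ (δ *₃ ρ) *₃ (sign₃ b *₃ A C₃ b) ∎
  rearrange (inj₂ R<s) = begin
    sign₃ b *₃ σ *₃ (nonzero₃ (res (n ∸ i)) *₃ (A C₃ b *₃ ρ))
      ≡⟨ cong (λ c → sign₃ b *₃ σ *₃ (nonzero₃ (res (n ∸ i)) *₃ (A C₃ b *₃ c))) (C₃-vanishes R<s) ⟩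
    sign₃ b *₃ σ *₃ (nonzero₃ (res (n ∸ i)) *₃ (A C₃ b *₃ 0₃))
      ≡⟨ ℤ₃-law 6 (λ a b c d e f → a *₃ b *₃ (c *₃ (d *₃ 0₃))) (λ a b c d e f → b *₃ (e *₃ 0₃) *₃ (a *₃ d))
           (sign₃ b) σ (nonzero₃ (res (n ∸ i))) (A C₃ b) δ ρ ⟩
    σ *₃ (δ *₃ 0₃) *₃ (sign₃ b *₃ A C₃ b)
      ≡⟨ cong (λ c → σ *₃ (δ *₃ c) *₃ (sign₃ b *₃ A C₃ b)) (sym (C₃-vanishes R<s)) ⟩
    σ *₃ (δ *₃ ρ) *₃ (sign₃ b *₃ A C₃ b) ∎

∑-eulerTerm-lucas : ∀ m A (r R : Fin 3) → suc (2 * (3 * m + toℕ r)) ≡ 3 * A + toℕ R →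
  ∀ M → (∀ b → b < M → ∀ (s : Fin 3) → 3 * b + toℕ s ≤ 3 * m + toℕ r ⊎ toℕ R < toℕ s) →
  ∑< (3 * M) (eulerTerm (3 * m + toℕ r)) ≡ digitFactor r R *₃ ∑[ b < M ] (sign₃ b *₃ A C₃ b)
∑-eulerTerm-lucas m A r R 2n+1≡3A+R M inRange = begin
  ∑< (3 * M) (eulerTerm n)              ≡⟨ ∑-blocks M (eulerTerm n) ⟩
  ∑[ b < M ] block (eulerTerm n) b      ≡⟨ ∑-cong M (λ b b<M → block≡ b (inRange b b<M)) ⟩
  ∑[ b < M ] (digitFactor r R *₃ g b)   ≡⟨ ∑-*ˡ M (digitFactor r R) g ⟩
  digitFactor r R *₃ ∑< M g             ∎
  where
  open ≡-Reasoning
  n = 3 * m + toℕ r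
  g = λ b → sign₃ b *₃ A C₃ b
  term = eulerTerm-lucas m A r R 2n+1≡3A+R
  block≡ : ∀ b → (∀ (s : Fin 3) → 3 * b + toℕ s ≤ n ⊎ toℕ R < toℕ s) → block (eulerTerm n) b ≡ digitFactor r R *₃ g b
  block≡ b ok = trans (cong₂ _+₃_ (cong₂ _+₃_ (term b 0F (ok 0F)) (term b 1F (ok 1F))) (term b 2F (ok 2F)))
    (ℤ₃-law 4 (λ x y z w → x *₃ w +₃ y *₃ w +₃ z *₃ w) (λ x y z w → (x +₃ y +₃ z) *₃ w)
      (digitTerm r R 0F) (digitTerm r R 1F) (digitTerm r R 2F) (g b))

lower-block≤ : ∀ {b m} (s : Fin 3) x → b < m → 3 * b + toℕ s ≤ 3 * m + x
lower-block≤ {b} {m} s x b<m = <⇒≤ (begin-strict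
  3 * b + toℕ s  <⟨ +-monoʳ-< (3 * b) (toℕ<n s) ⟩
  3 * b + 3      ≡⟨ +-comm (3 * b) 3 ⟩
  3 + 3 * b      ≡⟨ *-suc 3 b ⟨
  3 * suc b      ≤⟨ *-monoʳ-≤ 3 b<m ⟩
  3 * m          ≤⟨ m≤m+n (3 * m) x ⟩
  3 * m + x      ∎)
  where open ≤-Reasoning

blocksUpTo : ∀ {m} (r R : Fin 3) → (∀ (s : Fin 3) → 3 * m + toℕ s ≤ 3 * m + toℕ r ⊎ toℕ R < toℕ s) →
  ∀ b → b < suc m → ∀ (s : Fin 3) → 3 * b + toℕ s ≤ 3 * m + toℕ r ⊎ toℕ R < toℕ s
blocksUpTo r R top b b<1+m s with m<1+n⇒m<n∨m≡n b<1+m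
... | inj₁ b<m  = inj₁ (lower-block≤ s (toℕ r) b<m)
... | inj₂ refl = top s

A₃-3m+0 : ∀ k → A₃ (3 * suc k + 0) ≡ -₃ central₃ (suc k)
A₃-3m+0 k = begin
  A₃ n                                             ≡⟨ A₃-eulerTerm n (s≤s z≤n) ⟩
  ∑< (suc n) (eulerTerm n)                         ≡⟨ ∑-last-vanishes n (eulerTerm n) (eulerTerm-vanishes (≤-refl {n})) ⟩
  ∑< (3 * m + 0) (eulerTerm n)                     ≡⟨ cong (λ j → ∑< j (eulerTerm n)) (+-identityʳ (3 * m)) ⟩
  ∑< (3 * m) (eulerTerm n)                         ≡⟨ ∑-eulerTerm-lucas m (2 * m) 0F 1F (2n+1≡ m) m
                                                        (λ b b<m s → inj₁ (lower-block≤ s 0 b<m)) ⟩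
  -₃ ∑[ b < m ] (sign₃ b *₃ (2 * m) C₃ b)          ≡⟨ cong (λ N → -₃ ∑[ b < m ] (sign₃ b *₃ N C₃ b)) (*-suc 2 k) ⟩
  -₃ ∑[ b < m ] (sign₃ b *₃ suc N C₃ b)            ≡⟨ cong -₃_ (∑-alternating N k) ⟩
  -₃ (sign₃ k *₃ N C₃ k)                           ≡⟨ cong -₃_ (central₃-suc k) ⟨
  -₃ central₃ m                                    ∎
  where
  open ≡-Reasoning
  m = suc k
  n = 3 * m + 0
  N = suc (2 * k)
  2n+1≡ : ∀ m → suc (2 * (3 * m + 0)) ≡ 3 * (2 * m) + 1
  2n+1≡ = solve-∀

A₃-3m+1 : ∀ m → A₃ (3 * m + 1) ≡ central₃ m
A₃-3m+1 m = begin
  A₃ n                                             ≡⟨ A₃-eulerTerm n (m≤n+m 1 (3 * m)) ⟩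
  ∑< (suc n) (eulerTerm n)                         ≡⟨ ∑-last-vanishes (suc n) (eulerTerm n) (eulerTerm-vanishes (n≤1+n n)) ⟨
  ∑< (2 + n) (eulerTerm n)                         ≡⟨ cong (λ j → ∑< j (eulerTerm n)) (2+n≡ m) ⟩
  ∑< (3 * suc m) (eulerTerm n)                     ≡⟨ ∑-eulerTerm-lucas m (suc (2 * m)) 1F 0F (2n+1≡ m) (suc m)
                                                        (blocksUpTo 1F 0F top) ⟩
  ∑[ b < suc m ] (sign₃ b *₃ suc (2 * m) C₃ b)     ≡⟨ ∑-alternating (2 * m) m ⟩
  central₃ m                                       ∎
  where
  open ≡-Reasoning
  n = 3 * m + 1
  2n+1≡ : ∀ m → suc (2 * (3 * m + 1)) ≡ 3 * suc (2 * m) + 0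
  2n+1≡ = solve-∀
  2+n≡ : ∀ m → 2 + (3 * m + 1) ≡ 3 * suc m
  2+n≡ = solve-∀
  top : ∀ (s : Fin 3) → 3 * m + toℕ s ≤ n ⊎ 0 < toℕ s
  top 0F = inj₁ (+-monoʳ-≤ (3 * m) z≤n)
  top 1F = inj₂ z<s
  top 2F = inj₂ z<s

A₃-3m+2 : ∀ m → A₃ (3 * m + 2) ≡ -₃ central₃ m
A₃-3m+2 m = begin
  A₃ n                                             ≡⟨ A₃-eulerTerm n (≤-trans (s≤s z≤n) (m≤n+m 2 (3 * m))) ⟩
  ∑< (suc n) (eulerTerm n)                         ≡⟨ cong (λ j → ∑< j (eulerTerm n)) (1+n≡ m) ⟩
  ∑< (3 * suc m) (eulerTerm n)                     ≡⟨ ∑-eulerTerm-lucas m (suc (2 * m)) 2F 2F (2n+1≡ m) (suc m)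
                                                        (blocksUpTo 2F 2F top) ⟩
  -₃ ∑[ b < suc m ] (sign₃ b *₃ suc (2 * m) C₃ b)  ≡⟨ cong -₃_ (∑-alternating (2 * m) m) ⟩
  -₃ central₃ m                                    ∎
  where
  open ≡-Reasoning
  n = 3 * m + 2
  2n+1≡ : ∀ m → suc (2 * (3 * m + 2)) ≡ 3 * suc (2 * m) + 2
  2n+1≡ = solve-∀
  1+n≡ : ∀ m → 1 + (3 * m + 2) ≡ 3 * suc m
  1+n≡ = solve-∀
  top : ∀ (s : Fin 3) → 3 * m + toℕ s ≤ n ⊎ 2 < toℕ s
  top s = inj₁ (+-monoʳ-≤ (3 * m) (m<1+n⇒m≤n (toℕ<n s)))

-- The value of digitFactor r R, where R is the last base-3 digit of 2n + 1 for n ≡ r (mod 3).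
digitSign : Fin 3 → ℤ₃
digitSign 0F = -₃ 1₃
digitSign 1F = 1₃
digitSign 2F = -₃ 1₃

A₃-base3 : ∀ m (d : Fin 3) → 1 ≤ 3 * m + toℕ d → A₃ (3 * m + toℕ d) ≡ digitSign d *₃ central₃ m
A₃-base3 zero    0F ()
A₃-base3 (suc k) 0F _ = A₃-3m+0 k
A₃-base3 m       1F _ = A₃-3m+1 m
A₃-base3 m       2F _ = A₃-3m+2 m

A₃-inAff : ∀ {n} (d : Fin 3) → 1 ≤ n → InAff 3 (toℕ d) n → A₃ n ≡ digitSign d
A₃-inAff d n≥1 (m , t , refl) = trans (A₃-base3 m d n≥1)
  (trans (cong (digitSign d *₃_) (central₃-T01 t)) (ℤ₃-law 1 (λ x → x *₃ 1₃) (λ x → x) (digitSign d)))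

A₃-notInAff : ∀ {n} → Base3 n → 1 ≤ n → (∀ (d : Fin 3) → ¬ InAff 3 (toℕ d) n) → A₃ n ≡ 0₃
A₃-notInAff (_∷_ {q} d ds) n≥1 ¬inAff with central₃≡0⊎T01 ds
... | inj₂ t   = ⊥-elim (¬inAff d (q , t , x+q*3≡3q+x (toℕ d) q))
... | inj₁ c≡0 = begin
  A₃ (toℕ d + q * 3)            ≡⟨ cong A₃ (x+q*3≡3q+x (toℕ d) q) ⟩
  A₃ (3 * q + toℕ d)            ≡⟨ A₃-base3 q d (subst (1 ≤_) (x+q*3≡3q+x (toℕ d) q) n≥1) ⟩
  digitSign d *₃ central₃ q     ≡⟨ cong (digitSign d *₃_) c≡0 ⟩
  digitSign d *₃ 0₃             ≡⟨ ℤ₃-law 1 (λ x → x *₃ 0₃) (λ _ → 0₃) (digitSign d) ⟩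
  0₃                            ∎
  where open ≡-Reasoning

theorem5p10 : (n : ℕ) → n ≥ 1 →
    (InAff 3 1 n → eulerian (2 * n) n ≡₃ + 1)
    × ((InAff 3 0 n ⊎ InAff 3 2 n) → eulerian (2 * n) n ≡₃ - + 1)
    × ((¬ InAff 3 1 n × ¬ InAff 3 0 n × ¬ InAff 3 2 n) → eulerian (2 * n) n ≡₃ + 0)
theorem5p10 n n≥1 =
  ≡₃-from (+ 1) ∘ A₃-inAff 1F n≥1 ,
  [ ≡₃-from (- + 1) ∘ A₃-inAff 0F n≥1 , ≡₃-from (- + 1) ∘ A₃-inAff 2F n≥1 ] ,
  λ (¬1 , ¬0 , ¬2) → ≡₃-from (+ 0) (A₃-notInAff (base3 n) n≥1 λ { 0F → ¬0 ; 1F → ¬1 ; 2F → ¬2 })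
  where
  ≡₃-from : ∀ y → A₃ n ≡ resᶻ y → eulerian (2 * n) n ≡₃ y
  ≡₃-from = resᶻ-≡⇒≡₃ (eulerian (2 * n) n)
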